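{- Let $G\neq1$ be a finite abelian group, $R,L\subseteq G$ with $R=R^{ -1}$, $L=L^{ -1}$, $1\notin R\cup L$, $|R|=|L|=2$ and $|R\cap L|=1$, and let $\Gamma=\mathrm{SC}(G;R,L,\{1\})$ be connected. Then $\Gamma$ is transitive and non-normal, and one of the following holds: (1) there are $a,b\in G$ with $G=\langle a,b\rangle\cong\mathbb Z_2\times\mathbb Z_2$, $R=\{a,b\}$ and $L=\{ab,b\}$; (2) there are $a,b,c\in G$ with $G=\langle a,b,c\rangle\cong\mathbb Z_2\times\mathbb Z_2\times\mathbb Z_2$, $R=\{a,b\}$ and $L=\{b,c\}$.
   Context: $\mathrm{SC}(G;R,L,\{1\})$ is the graph with vertex set $G\times\{1,2\}$ and edges $\{(x,1),(y,1)\}$ for $yx^{ -1}\in R$, $\{(x,2),(y,2)\}$ for $yx^{ -1}\in L$, and $\{(x,1),(x,2)\}$ for $x\in G$. $R_G=\{\rho_g\mid g\in G\}$ where $(x,i)^{\rho_g}=(xg,i)$; $\Gamma$ is normal if $R_G\trianglelefteq\mathrm{Aut}(\Gamma)$. Transitive means vertex-transitive. -}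

module Defs where

open import Data.Nat using (ℕ)
open import Data.Fin using (Fin; zero; suc)
open import Data.Fin.Subset using (Subset; _∈_; _∉_; _∩_; _∪_; ∣_∣; ⁅_⁆)
open import Data.Bool using (Bool; _xor_)
open import Data.Product using (Σ; ∃; ∃-syntax; _×_; _,_)
open import Data.Sum using (_⊎_)
open import Data.List using (List; _∷_; [])
open import Data.List.Membership.Propositional using () renaming (_∈_ to _∈ˡ_)
open import Function.Bundles using (_↔_; Inverse)
open import Algebra.Structures using (IsAbelianGroup)
open import Relation.Binary.PropositionalEquality using (_≡_)
open import Relation.Binary.Construct.Closure.ReflexiveTransitive using (Star)

-- A finite abelian group, realised on the carrier Fin n (every finite group
-- is isomorphic to one of this form), with propositional equality.
record FinAbGroup : Set where
  infixl 7 _∙_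
  infix 8 _⁻¹
  field
    n : ℕ
    _∙_ : Fin n → Fin n → Fin n
    ε : Fin n
    _⁻¹ : Fin n → Fin n
    isAbelianGroup : IsAbelianGroup _≡_ _∙_ ε _⁻¹

module _ (G : FinAbGroup) where
  open FinAbGroup G

  InvClosed : Subset n → Set
  InvClosed S = ∀ x → x ∈ S → (x ⁻¹) ∈ S

  -- vertices G × {1,2}; layer 1 = zero, layer 2 = suc zero
  V : Set
  V = Fin n × Fin 2

  data SCEdge (R L : Subset n) : V → V → Set where
    edge₁ : ∀ {x y} → (y ∙ x ⁻¹) ∈ R → SCEdge R L (x , zero) (y , zero)
    edge₂ : ∀ {x y} → (y ∙ x ⁻¹) ∈ L → SCEdge R L (x , suc zero) (y , suc zero)
    spoke : ∀ {x} → SCEdge R L (x , zero) (x , suc zero)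

  SCAdj : Subset n → Subset n → V → V → Set
  SCAdj R L u v = SCEdge R L u v ⊎ SCEdge R L v u

  ρ : Fin n → V → V
  ρ g (x , i) = (x ∙ g , i)

  data ⟨_⟩ (S : List (Fin n)) : Fin n → Set where
    gen  : ∀ {x} → x ∈ˡ S → ⟨ S ⟩ x
    unit : ⟨ S ⟩ ε
    mul  : ∀ {x y} → ⟨ S ⟩ x → ⟨ S ⟩ y → ⟨ S ⟩ (x ∙ y)
    inv  : ∀ {x} → ⟨ S ⟩ x → ⟨ S ⟩ (x ⁻¹)

  IsoTo : (H : Set) → (H → H → H) → Set
  IsoTo H _·_ = Σ (Fin n ↔ H) λ φ →
    ∀ x y → Inverse.to φ (x ∙ y) ≡ (Inverse.to φ x · Inverse.to φ y)

module _ {Vt : Set} (Adj : Vt → Vt → Set) where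

  Connected : Set
  Connected = ∀ u v → Star Adj u v

  record Automorphism : Set where
    field
      perm      : Vt ↔ Vt
      preserves : ∀ u v → Adj u v → Adj (Inverse.to perm u) (Inverse.to perm v)
      reflects  : ∀ u v → Adj (Inverse.to perm u) (Inverse.to perm v) → Adj u v

  VertexTransitive : Set
  VertexTransitive = ∀ u v → ∃[ σ ] Inverse.to (Automorphism.perm σ) u ≡ v

-- R_G ⊴ Aut(Γ): every conjugate σ ρ_g σ⁻¹ of an element of R_G by an
-- automorphism σ is again in R_G (as permutations of the vertex set).
Normal : (G : FinAbGroup) → (V G → V G → Set) → Set
Normal G Adj = ∀ (σ : Automorphism Adj) (g : Fin (FinAbGroup.n G)) →
  ∃[ h ] ∀ v → Inverse.to (Automorphism.perm σ) (ρ G g (Inverse.from (Automorphism.perm σ) v)) ≡ ρ G h v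

-- Z₂ × Z₂ and Z₂ × Z₂ × Z₂ (Z₂ = Bool under xor)
_⊕²_ : Bool × Bool → Bool × Bool → Bool × Bool
(a , b) ⊕² (c , d) = (a xor c , b xor d)

_⊕³_ : Bool × Bool × Bool → Bool × Bool × Bool → Bool × Bool × Bool
(a , b , c) ⊕³ (d , e , f) = (a xor d , b xor e , c xor f)

module Submission where

-- By inverse-closedness and |R ∩ L| = 1, R = {a, b} and L = {b, c} for three distinct
-- involutions a, b, c, and connectivity gives G = ⟨a, b, c⟩. An abelian group generated by
-- involutions has exponent two, so G ≅ Z₂² with c = ab, or G ≅ Z₂³ with a, b, c a basis.
-- In these coordinates Γ is an explicit graph on 8 or 16 vertices, and a single
-- automorphism ν of it fixes the vertex (1, layer 1) but sends its neighbour (a, layer 1)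
-- to the other layer. Since R_G is transitive on each layer, ν makes Γ vertex-transitive;
-- since R_G preserves layers while ν ρ_a ν⁻¹ does not, R_G is not normal.

open import Defs
import Data.Nat.Properties as ℕ
open import Data.Fin using (Fin; zero; suc)
import Data.Fin.Properties as Fin
open import Data.Fin.Subset using (Subset; _∈_; _∉_; _∩_; _∪_; ∣_∣; ⁅_⁆; inside; outside)
open import Data.Fin.Subset.Properties
  using (x∈p∩q⁺; x∈p∩q⁻; x∈p∪q⁺; x∈p∪q⁻; x∈⁅x⁆; x∈⁅y⁆⇒x≡y; ⊆-antisym)
open import Data.Vec using (_∷_; here; there)
open import Data.Bool using (Bool; true; false; not; _xor_)
import Data.Bool.Properties as Bool
open import Data.Product using (∃; ∃-syntax; _×_; _,_; proj₁; proj₂; map₂)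
open import Data.Product.Properties using (≡-dec)
open import Data.Sum using (_⊎_; inj₁; inj₂; [_,_]′)
import Data.Sum as Sum
open import Data.Empty using (⊥; ⊥-elim)
open import Data.List using (List; _∷_; [])
open import Data.List.Membership.Propositional using () renaming (_∈_ to _∈ˡ_)
open import Data.List.Relation.Unary.Any using (here; there)
open import Function using (_∘_; id)
open import Function.Bundles using (Inverse; mk↔ₛ′)
open import Function.Definitions using (Injective)
open import Function.Construct.Composition using (_↔-∘_)
open import Function.Construct.Symmetry using (↔-sym)
open import Algebra.Bundles using (AbelianGroup)
import Algebra.Properties.AbelianGroup as AbelianGroupProperties
import Algebra.Properties.CommutativeSemigroup as CommutativeSemigroupProperties
import Algebra.Morphism.Definitions as MorphismDefinitions
open import Relation.Binary.Definitions using (DecidableEquality)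
open import Relation.Binary.PropositionalEquality
  using (_≡_; _≢_; refl; sym; trans; cong; cong₂; subst; subst₂; module ≡-Reasoning)
open import Relation.Binary.Construct.Closure.ReflexiveTransitive using (Star; _◅_)
  renaming (ε to [])
open import Relation.Nullary using (¬_; Dec)
open import Relation.Nullary.Decidable using (yes; no; map′; _×-dec_; _⊎-dec_; _→-dec_; from-yes)
open import Relation.Unary using (Decidable)

∣p∣≡0⇒∉ : ∀ {n} {p : Subset n} → ∣ p ∣ ≡ 0 → ∀ {x} → x ∉ p
∣p∣≡0⇒∉ {p = outside ∷ p} ∣p∣≡0 (there x∈p) = ∣p∣≡0⇒∉ ∣p∣≡0 x∈p

∣p∣≡1⇒singleton : ∀ {n} {p : Subset n} → ∣ p ∣ ≡ 1 →
                  ∃[ x ] x ∈ p × (∀ {y} → y ∈ p → y ≡ x)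
∣p∣≡1⇒singleton {p = inside ∷ p} ∣p∣≡1 = zero , here , λ
  { here → refl
  ; (there y∈p) → ⊥-elim (∣p∣≡0⇒∉ (ℕ.suc-injective ∣p∣≡1) y∈p) }
∣p∣≡1⇒singleton {p = outside ∷ p} ∣p∣≡1 with ∣p∣≡1⇒singleton ∣p∣≡1
... | x , x∈p , unique = suc x , there x∈p , λ { (there y∈p) → cong suc (unique y∈p) }

∣p∣≡2⇒pair : ∀ {n} {p : Subset n} {x} → ∣ p ∣ ≡ 2 → x ∈ p →
             ∃[ y ] y ∈ p × y ≢ x × (∀ {z} → z ∈ p → z ≡ y ⊎ z ≡ x)
∣p∣≡2⇒pair {p = inside ∷ p} ∣p∣≡2 here with ∣p∣≡1⇒singleton (ℕ.suc-injective ∣p∣≡2)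
... | y , y∈p , unique = suc y , there y∈p , (λ ()) , λ
  { here → inj₂ refl
  ; (there z∈p) → inj₁ (cong suc (unique z∈p)) }
∣p∣≡2⇒pair {p = inside ∷ p} ∣p∣≡2 (there x∈p) with ∣p∣≡1⇒singleton (ℕ.suc-injective ∣p∣≡2)
... | _ , _ , unique = zero , here , (λ ()) , λ
  { here → inj₁ refl
  ; (there z∈p) → inj₂ (cong suc (trans (unique z∈p) (sym (unique x∈p)))) }
∣p∣≡2⇒pair {p = outside ∷ p} ∣p∣≡2 (there x∈p) with ∣p∣≡2⇒pair ∣p∣≡2 x∈p
... | y , y∈p , y≢x , cover = suc y , there y∈p , y≢x ∘ Fin.suc-injective , λ
  { (there z∈p) → Sum.map (cong suc) (cong suc) (cover z∈p) }

≡⁅x⁆∪⁅y⁆ : ∀ {n} {p : Subset n} {x y} → x ∈ p → y ∈ p →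
           (∀ {z} → z ∈ p → z ≡ x ⊎ z ≡ y) → p ≡ ⁅ x ⁆ ∪ ⁅ y ⁆
≡⁅x⁆∪⁅y⁆ {p = p} {x} {y} x∈p y∈p cover = ⊆-antisym
  (λ z∈p → x∈p∪q⁺ (Sum.map (λ { refl → x∈⁅x⁆ x }) (λ { refl → x∈⁅x⁆ y }) (cover z∈p)))
  (λ z∈xy → [ (λ z∈x → subst (_∈ p) (sym (x∈⁅y⁆⇒x≡y x z∈x)) x∈p)
            , (λ z∈y → subst (_∈ p) (sym (x∈⁅y⁆⇒x≡y y z∈y)) y∈p) ]′ (x∈p∪q⁻ ⁅ x ⁆ ⁅ y ⁆ z∈xy))

fin2-cover : {i j : Fin 2} → i ≢ j → ∀ k → k ≡ i ⊎ k ≡ j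
fin2-cover {zero}     {zero}     i≢j _          = ⊥-elim (i≢j refl)
fin2-cover {suc zero} {suc zero} i≢j _          = ⊥-elim (i≢j refl)
fin2-cover {zero}     {suc zero} _   zero       = inj₁ refl
fin2-cover {zero}     {suc zero} _   (suc zero) = inj₂ refl
fin2-cover {suc zero} {zero}     _   zero       = inj₂ refl
fin2-cover {suc zero} {zero}     _   (suc zero) = inj₁ refl

-- Automorphisms and orbits of an arbitrary graph

module _ {V : Set} {Adj : V → V → Set} where

  act : Automorphism Adj → V → V
  act σ = Inverse.to (Automorphism.perm σ)

  automorphism : (f g : V → V) → (∀ v → f (g v) ≡ v) → (∀ v → g (f v) ≡ v) →
                 (∀ {u v} → Adj u v → Adj (f u) (f v)) →
                 (∀ {u v} → Adj u v → Adj (g u) (g v)) → Automorphism Adj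
  automorphism f g f∘g g∘f f-adj g-adj = record
    { perm      = mk↔ₛ′ f g f∘g g∘f
    ; preserves = λ _ _ → f-adj
    ; reflects  = λ u v adj → subst₂ Adj (g∘f u) (g∘f v) (g-adj adj)
    }

  _∘ᵃ_ : Automorphism Adj → Automorphism Adj → Automorphism Adj
  σ ∘ᵃ τ = record
    { perm      = σ.perm ↔-∘ τ.perm
    ; preserves = λ u v → σ.preserves _ _ ∘ τ.preserves u v
    ; reflects  = λ u v → τ.reflects u v ∘ σ.reflects _ _
    }
    where
    module σ = Automorphism σ
    module τ = Automorphism τ

  _⁻¹ᵃ : Automorphism Adj → Automorphism Adj
  σ ⁻¹ᵃ = record
    { perm      = ↔-sym σ.perm
    ; preserves = λ u v → σ.reflects _ _ ∘ subst₂ Adj (sym (to∘from u)) (sym (to∘from v))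
    ; reflects  = λ u v → subst₂ Adj (to∘from u) (to∘from v) ∘ σ.preserves _ _
    }
    where
    module σ = Automorphism σ
    to∘from : ∀ v → Inverse.to σ.perm (Inverse.from σ.perm v) ≡ v
    to∘from = Inverse.strictlyInverseˡ σ.perm

  SameOrbit : V → V → Set
  SameOrbit u v = ∃[ σ ] act σ u ≡ v

  orbit-sym : ∀ {u v} → SameOrbit u v → SameOrbit v u
  orbit-sym {u} (σ , refl) = σ ⁻¹ᵃ , Inverse.strictlyInverseʳ (Automorphism.perm σ) u

  orbit-trans : ∀ {u v w} → SameOrbit u v → SameOrbit v w → SameOrbit u w
  orbit-trans (σ , refl) (τ , refl) = τ ∘ᵃ σ , refl

Searchable : Set → Set₁
Searchable A = ∀ {P : A → Set} → Decidable P → Dec (∀ x → P x)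

searchable-Bool : Searchable Bool
searchable-Bool P? = map′ (λ (pf , pt) → λ { false → pf ; true → pt })
                          (λ all → all false , all true)
                          (P? false ×-dec P? true)

searchable-× : ∀ {A B} → Searchable A → Searchable B → Searchable (A × B)
searchable-× all-A? all-B? P? = map′ (λ all (x , y) → all x y) (λ all x y → all (x , y))
                                     (all-A? λ x → all-B? λ y → P? (x , y))

-- The graph SC(C; {a,b}, {b,c}, {1}) over a concrete group C

module ConcreteSC {C : Set} (_⊕_ : C → C → C) (_≟_ : DecidableEquality C) (a b c : C) where

  R̂ L̂ : C → Set
  R̂ r = r ≡ a ⊎ r ≡ b
  L̂ r = r ≡ b ⊎ r ≡ c

  Vertex : Set
  Vertex = C × Fin 2

  Edge : Vertex → Vertex → Set
  Edge (p , zero)     (q , zero)     = R̂ (q ⊕ p)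
  Edge (p , zero)     (q , suc zero) = p ≡ q
  Edge (p , suc zero) (q , zero)     = ⊥
  Edge (p , suc zero) (q , suc zero) = L̂ (q ⊕ p)

  Adj : Vertex → Vertex → Set
  Adj u v = Edge u v ⊎ Edge v u

  edge? : ∀ u v → Dec (Edge u v)
  edge? (p , zero)     (q , zero)     = ((q ⊕ p) ≟ a) ⊎-dec ((q ⊕ p) ≟ b)
  edge? (p , zero)     (q , suc zero) = p ≟ q
  edge? (p , suc zero) (q , zero)     = no λ ()
  edge? (p , suc zero) (q , suc zero) = ((q ⊕ p) ≟ b) ⊎-dec ((q ⊕ p) ≟ c)

  IsAutomorphicInvolution : (Vertex → Vertex) → Set
  IsAutomorphicInvolution ν = (∀ u → ν (ν u) ≡ u) × (∀ u v → Adj u v → Adj (ν u) (ν v))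

  isAutomorphicInvolution? : Searchable C → ∀ ν → Dec (IsAutomorphicInvolution ν)
  isAutomorphicInvolution? all-C? ν =
    all? (λ u → ≡-dec _≟_ Fin._≟_ (ν (ν u)) u) ×-dec
    all? (λ u → all? λ v → adj? u v →-dec adj? (ν u) (ν v))
    where
    all? : Searchable Vertex
    all? = searchable-× all-C? Fin.all?
    adj? : ∀ u v → Dec (Adj u v)
    adj? u v = edge? u v ⊎-dec edge? v u

module _ (G : FinAbGroup) where
  open FinAbGroup G

  private
    abelianGroup : AbelianGroup _ _
    abelianGroup = record { isAbelianGroup = isAbelianGroup }

  open AbelianGroup abelianGroup
    using (assoc; comm; identityˡ; identityʳ; inverseʳ; commutativeSemigroup)
  open AbelianGroupProperties abelianGroup
    using (inverseʳ-unique; ⁻¹-involutive; ⁻¹-∙-comm; ⁻¹-anti-homo-//; ε⁻¹≈ε; ∙-cancelˡ;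
           //-rightDividesˡ; //-rightDividesʳ; \\-leftDividesˡ)
  open CommutativeSemigroupProperties commutativeSemigroup using (interchange)
  open ≡-Reasoning

  ⟪_⟫ : List (Fin n) → Fin n → Set
  ⟪ S ⟫ = ⟨_⟩ G S

  x⁻¹≡x⇒x∙x≡ε : ∀ {x} → x ⁻¹ ≡ x → x ∙ x ≡ ε
  x⁻¹≡x⇒x∙x≡ε {x} x⁻¹≡x = trans (cong (x ∙_) (sym x⁻¹≡x)) (inverseʳ x)

  yg∙[xg]⁻¹≡yx⁻¹ : ∀ x y g → (y ∙ g) ∙ (x ∙ g) ⁻¹ ≡ y ∙ x ⁻¹
  yg∙[xg]⁻¹≡yx⁻¹ x y g = begin
    (y ∙ g) ∙ (x ∙ g) ⁻¹         ≡⟨ cong ((y ∙ g) ∙_) (sym (⁻¹-∙-comm x g)) ⟩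
    (y ∙ g) ∙ (x ⁻¹ ∙ g ⁻¹)      ≡⟨ interchange y g (x ⁻¹) (g ⁻¹) ⟩
    (y ∙ x ⁻¹) ∙ (g ∙ g ⁻¹)      ≡⟨ cong ((y ∙ x ⁻¹) ∙_) (inverseʳ g) ⟩
    (y ∙ x ⁻¹) ∙ ε               ≡⟨ identityʳ _ ⟩
    y ∙ x ⁻¹                     ∎

  [yx⁻¹]⁻¹y≡x : ∀ x y → (y ∙ x ⁻¹) ⁻¹ ∙ y ≡ x
  [yx⁻¹]⁻¹y≡x x y = trans (cong (_∙ y) (⁻¹-anti-homo-// y x)) (//-rightDividesˡ y x)

  ⟨⟩-involutive : ∀ {S} → (∀ {s} → s ∈ˡ S → s ∙ s ≡ ε) → ∀ {x} → ⟪ S ⟫ x → x ∙ x ≡ ε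
  ⟨⟩-involutive involutive (gen s∈S) = involutive s∈S
  ⟨⟩-involutive involutive unit = identityʳ ε
  ⟨⟩-involutive involutive (mul {x} {y} p q) = begin
    (x ∙ y) ∙ (x ∙ y)  ≡⟨ interchange x y x y ⟩
    (x ∙ x) ∙ (y ∙ y)  ≡⟨ cong₂ _∙_ (⟨⟩-involutive involutive p) (⟨⟩-involutive involutive q) ⟩
    ε ∙ ε              ≡⟨ identityʳ ε ⟩
    ε                  ∎
  ⟨⟩-involutive involutive (inv {x} p) = begin
    x ⁻¹ ∙ x ⁻¹  ≡⟨ ⁻¹-∙-comm x x ⟩
    (x ∙ x) ⁻¹   ≡⟨ cong _⁻¹ (⟨⟩-involutive involutive p) ⟩
    ε ⁻¹         ≡⟨ ε⁻¹≈ε ⟩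
    ε            ∎

  module SCGraph (R L : Subset n) where

    Γ : V G → V G → Set
    Γ = SCAdj G R L

    layer : V G → Fin 2
    layer = proj₂

    translation : Fin n → Automorphism Γ
    translation g = automorphism (ρ G g) (ρ G (g ⁻¹))
      (λ (x , i) → cong (_, i) (//-rightDividesˡ g x))
      (λ (x , i) → cong (_, i) (//-rightDividesʳ g x))
      (Sum.map (translate g) (translate g)) (Sum.map (translate (g ⁻¹)) (translate (g ⁻¹)))
      where
      translate : ∀ g {u v} → SCEdge G R L u v → SCEdge G R L (ρ G g u) (ρ G g v)
      translate g (edge₁ {x} {y} d) = edge₁ (subst (_∈ R) (sym (yg∙[xg]⁻¹≡yx⁻¹ x y g)) d)
      translate g (edge₂ {x} {y} d) = edge₂ (subst (_∈ L) (sym (yg∙[xg]⁻¹≡yx⁻¹ x y g)) d)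
      translate g spoke             = spoke

    sameLayer : ∀ {u v} → layer u ≡ layer v → SameOrbit u v
    sameLayer {x , i} {y , .i} refl = translation (x ⁻¹ ∙ y) , cong (_, i) (\\-leftDividesˡ x y)

    vertexTransitive : ∀ {u v} → SameOrbit u v → layer u ≢ layer v → VertexTransitive Γ
    vertexTransitive {u} {v} u~v layers-differ s t = orbit-trans (toU s) (orbit-sym (toU t))
      where
      toU : ∀ s → SameOrbit s u
      toU s = [ sameLayer , (λ s~v → orbit-trans (sameLayer s~v) (orbit-sym u~v)) ]′
                (fin2-cover layers-differ (layer s))

    -- Every element of R_G preserves layers, hence so does each of its conjugates.
    ¬normal : (σ : Automorphism Γ) (g : Fin n) (u : V G) →
              layer (act σ (ρ G g u)) ≢ layer (act σ u) → ¬ Normal G Γ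
    ¬normal σ g u layer-changes normal = layer-changes (cong layer conjugate)
      where
      conjugate : act σ (ρ G g u) ≡ ρ G (proj₁ (normal σ g)) (act σ u)
      conjugate = trans (cong (act σ ∘ ρ G g) (sym (Inverse.strictlyInverseʳ (Automorphism.perm σ) u)))
                        (proj₂ (normal σ g) (act σ u))

    connected⇒generated : ∀ {S} → (∀ {s} → s ∈ R ⊎ s ∈ L → ⟪ S ⟫ s) → Connected Γ → ∀ x → ⟪ S ⟫ x
    connected⇒generated {S} generators connected x = walk (connected (ε , zero) (x , zero)) unit
      where
      Reached : V G → Set
      Reached (x , _) = ⟪ S ⟫ x

      across : ∀ {x y} → ⟪ S ⟫ (y ∙ x ⁻¹) → (⟪ S ⟫ x → ⟪ S ⟫ y) × (⟪ S ⟫ y → ⟪ S ⟫ x)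
      across {x} {y} d = (λ r → subst ⟪ S ⟫ (//-rightDividesˡ x y) (mul d r))
                       , (λ r → subst ⟪ S ⟫ ([yx⁻¹]⁻¹y≡x x y) (mul (inv d) r))

      along : ∀ {u v} → SCEdge G R L u v → (Reached u → Reached v) × (Reached v → Reached u)
      along (edge₁ d) = across (generators (inj₁ d))
      along (edge₂ d) = across (generators (inj₂ d))
      along spoke     = id , id

      walk : ∀ {u v} → Star Γ u v → Reached u → Reached v
      walk []               r = r
      walk (inj₁ e ◅ steps) r = walk steps (proj₁ (along e) r)
      walk (inj₂ e ◅ steps) r = walk steps (proj₂ (along e) r)

  record Shape (R L : Subset n) : Set where
    field
      a b c          : Fin n
      a∈R            : a ∈ R
      b∈R            : b ∈ R
      b∈L            : b ∈ L
      c∈L            : c ∈ L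
      R⊆             : ∀ {y} → y ∈ R → y ≡ a ⊎ y ≡ b
      L⊆             : ∀ {y} → y ∈ L → y ≡ b ⊎ y ≡ c
      a-involution   : a ∙ a ≡ ε
      b-involution   : b ∙ b ≡ ε
      c-involution   : c ∙ c ≡ ε
      a≢ε            : a ≢ ε
      b≢ε            : b ≢ ε
      c≢ε            : c ≢ ε
      a≢b            : a ≢ b
      b≢c            : b ≢ c
      a≢c            : a ≢ c

  shape : ∀ {R L} → InvClosed G R → InvClosed G L → ε ∉ R ∪ L →
          ∣ R ∣ ≡ 2 → ∣ L ∣ ≡ 2 → ∣ R ∩ L ∣ ≡ 1 → Shape R L
  shape {R} {L} R⁻¹ L⁻¹ ε∉R∪L ∣R∣≡2 ∣L∣≡2 ∣R∩L∣≡1 with ∣p∣≡1⇒singleton ∣R∩L∣≡1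
  ... | b , b∈R∩L , R∩L⊆b with x∈p∩q⁻ R L b∈R∩L
  ... | b∈R , b∈L with ∣p∣≡2⇒pair ∣R∣≡2 b∈R | ∣p∣≡2⇒pair ∣L∣≡2 b∈L
  ... | a , a∈R , a≢b , R⊆ | c , c∈L , c≢b , L⊆ = record
    { a = a ; b = b ; c = c
    ; a∈R = a∈R ; b∈R = b∈R ; b∈L = b∈L ; c∈L = c∈L
    ; R⊆ = R⊆ ; L⊆ = Sum.swap ∘ L⊆
    ; a-involution = x⁻¹≡x⇒x∙x≡ε (other-selfInverse R⁻¹ a≢b R⊆ a∈R)
    ; b-involution = x⁻¹≡x⇒x∙x≡ε b⁻¹≡b
    ; c-involution = x⁻¹≡x⇒x∙x≡ε (other-selfInverse L⁻¹ c≢b L⊆ c∈L)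
    ; a≢ε = ≢ε (inj₁ a∈R) ; b≢ε = ≢ε (inj₁ b∈R) ; c≢ε = ≢ε (inj₂ c∈L)
    ; a≢b = a≢b ; b≢c = c≢b ∘ sym
    ; a≢c = λ { refl → a≢b (R∩L⊆b (x∈p∩q⁺ (a∈R , c∈L))) }
    }
    where
    ≢ε : ∀ {x} → x ∈ R ⊎ x ∈ L → x ≢ ε
    ≢ε x∈R∪L refl = ε∉R∪L (x∈p∪q⁺ x∈R∪L)

    b⁻¹≡b : b ⁻¹ ≡ b
    b⁻¹≡b = R∩L⊆b (x∈p∩q⁺ (R⁻¹ b b∈R , L⁻¹ b b∈L))

    other-selfInverse : ∀ {S x} → InvClosed G S → x ≢ b → (∀ {y} → y ∈ S → y ≡ x ⊎ y ≡ b) →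
                        x ∈ S → x ⁻¹ ≡ x
    other-selfInverse {x = x} S⁻¹ x≢b S⊆ x∈S with S⊆ (S⁻¹ x x∈S)
    ... | inj₁ x⁻¹≡x = x⁻¹≡x
    ... | inj₂ x⁻¹≡b = ⊥-elim (x≢b (begin
      x         ≡⟨ ⁻¹-involutive x ⟨
      x ⁻¹ ⁻¹   ≡⟨ cong _⁻¹ x⁻¹≡b ⟩
      b ⁻¹      ≡⟨ b⁻¹≡b ⟩
      b         ∎))

  -- Coordinates in a group of exponent two

  Hom : {C : Set} → (C → C → C) → (C → Fin n) → Set
  Hom {C} _⊕_ w = MorphismDefinitions.Homomorphic₂ C (Fin n) _≡_ w _⊕_ _∙_

  _^_ : Fin n → Bool → Fin n
  x ^ true  = x
  x ^ false = ε

  xor× : {C : Set} → (C → C → C) → Bool × C → Bool × C → Bool × C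
  xor× _⊕_ (i , p) (j , q) = i xor j , p ⊕ q

  extend : {C : Set} → Fin n → (C → Fin n) → Bool × C → Fin n
  extend x w (i , p) = x ^ i ∙ w p

  module Exponent2 (elementary : ∀ x → x ∙ x ≡ ε) where

    self-inverse : ∀ x → x ⁻¹ ≡ x
    self-inverse x = sym (inverseʳ-unique x x (elementary x))

    x∙y≡z⇒y≡x∙z : ∀ {x y z} → x ∙ y ≡ z → y ≡ x ∙ z
    x∙y≡z⇒y≡x∙z {x} {y} {z} x∙y≡z = begin
      y            ≡⟨ identityˡ y ⟨
      ε ∙ y        ≡⟨ cong (_∙ y) (elementary x) ⟨
      (x ∙ x) ∙ y  ≡⟨ assoc x x y ⟩
      x ∙ (x ∙ y)  ≡⟨ cong (x ∙_) x∙y≡z ⟩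
      x ∙ z        ∎

    ^-hom : ∀ x → Hom _xor_ (x ^_)
    ^-hom x true  true  = sym (elementary x)
    ^-hom x true  false = sym (identityʳ x)
    ^-hom x false j     = sym (identityˡ (x ^ j))

    ^-injective : ∀ {x} → x ≢ ε → Injective _≡_ _≡_ (x ^_)
    ^-injective x≢ε {true}  {true}  _    = refl
    ^-injective x≢ε {true}  {false} x≡ε  = ⊥-elim (x≢ε x≡ε)
    ^-injective x≢ε {false} {true}  ε≡x  = ⊥-elim (x≢ε (sym ε≡x))
    ^-injective x≢ε {false} {false} _    = refl

    extend-hom : ∀ {C} {_⊕_ : C → C → C} {w} x → Hom _⊕_ w → Hom (xor× _⊕_) (extend x w)
    extend-hom {_⊕_ = _⊕_} {w} x w-hom (i , p) (j , q) = begin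
      x ^ (i xor j) ∙ w (p ⊕ q)      ≡⟨ cong₂ _∙_ (^-hom x i j) (w-hom p q) ⟩
      (x ^ i ∙ x ^ j) ∙ (w p ∙ w q)  ≡⟨ interchange _ _ _ _ ⟩
      (x ^ i ∙ w p) ∙ (x ^ j ∙ w q)  ∎

    -- The image of w is a subgroup not containing x, so x ^ i ∙ w p determines i, and then p.
    extend-injective : ∀ {C} {_⊕_ : C → C → C} {w} {x} → Hom _⊕_ w → Injective _≡_ _≡_ w →
                       (∀ p → w p ≢ x) → Injective _≡_ _≡_ (extend x w)
    extend-injective {_⊕_ = _⊕_} {w} {x} w-hom w-injective x∉image = injective
      where
      mixed : ∀ {p q} → x ∙ w p ≢ ε ∙ w q
      mixed {p} {q} eq = x∉image (p ⊕ q) (begin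
        w (p ⊕ q)  ≡⟨ w-hom p q ⟩
        w p ∙ w q  ≡⟨ x∙y≡z⇒y≡x∙z (trans (comm (w p) x) (trans eq (identityˡ (w q)))) ⟨
        x          ∎)

      injective : Injective _≡_ _≡_ (extend x w)
      injective {false , p} {false , q} eq = cong (false ,_) (w-injective (∙-cancelˡ ε (w p) (w q) eq))
      injective {true  , p} {true  , q} eq = cong (true ,_) (w-injective (∙-cancelˡ x (w p) (w q) eq))
      injective {true  , p} {false , q} eq = ⊥-elim (mixed eq)
      injective {false , p} {true  , q} eq = ⊥-elim (mixed (sym eq))

    ⟨⟩⊆image : ∀ {C} {_⊕_ : C → C → C} {w} {S} → Hom _⊕_ w → C →
               (∀ {s} → s ∈ˡ S → ∃ λ p → w p ≡ s) → ∀ {x} → ⟪ S ⟫ x → ∃ λ p → w p ≡ x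
    ⟨⟩⊆image w-hom p₀ basis (gen s∈S) = basis s∈S
    ⟨⟩⊆image {_⊕_ = _⊕_} w-hom p₀ basis unit = p₀ ⊕ p₀ , trans (w-hom p₀ p₀) (elementary _)
    ⟨⟩⊆image {_⊕_ = _⊕_} w-hom p₀ basis (mul x y)
      with ⟨⟩⊆image w-hom p₀ basis x | ⟨⟩⊆image w-hom p₀ basis y
    ... | p , refl | q , refl = p ⊕ q , w-hom p q
    ⟨⟩⊆image {w = w} w-hom p₀ basis (inv x) with ⟨⟩⊆image w-hom p₀ basis x
    ... | p , refl = p , sym (self-inverse (w p))

    bijectiveHom⇒IsoTo : ∀ {C} {_⊕_ : C → C → C} {w} → Hom _⊕_ w → Injective _≡_ _≡_ w →
                         (∀ x → ∃ λ p → w p ≡ x) → IsoTo G C _⊕_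
    bijectiveHom⇒IsoTo {C} {_⊕_} {w} w-hom w-injective w-surjective = mk↔ₛ′ ψ w ψ∘w w∘ψ , ψ-hom
      where
      ψ : Fin n → C
      ψ = proj₁ ∘ w-surjective

      w∘ψ : ∀ x → w (ψ x) ≡ x
      w∘ψ = proj₂ ∘ w-surjective

      ψ∘w : ∀ p → ψ (w p) ≡ p
      ψ∘w p = w-injective (w∘ψ (w p))

      ψ-hom : ∀ x y → ψ (x ∙ y) ≡ ψ x ⊕ ψ y
      ψ-hom x y = w-injective (begin
        w (ψ (x ∙ y))        ≡⟨ w∘ψ (x ∙ y) ⟩
        x ∙ y                ≡⟨ cong₂ _∙_ (w∘ψ x) (w∘ψ y) ⟨
        w (ψ x) ∙ w (ψ y)    ≡⟨ w-hom (ψ x) (ψ y) ⟨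
        w (ψ x ⊕ ψ y)        ∎)

    module Transfer {R L : Subset n} (s : Shape R L) {C : Set} {_⊕_ : C → C → C}
                    (iso : IsoTo G C _⊕_) (_≟_ : DecidableEquality C) {â b̂ ĉ : C}
                    (w-â : Inverse.from (proj₁ iso) â ≡ Shape.a s)
                    (w-b̂ : Inverse.from (proj₁ iso) b̂ ≡ Shape.b s)
                    (w-ĉ : Inverse.from (proj₁ iso) ĉ ≡ Shape.c s) where
      open Shape s
      open SCGraph R L
      open ConcreteSC _⊕_ _≟_ â b̂ ĉ public

      ψ : Fin n → C
      ψ = Inverse.to (proj₁ iso)

      w : C → Fin n
      w = Inverse.from (proj₁ iso)

      ψ∘w : ∀ p → ψ (w p) ≡ p
      ψ∘w = Inverse.strictlyInverseˡ (proj₁ iso)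

      w∘ψ : ∀ x → w (ψ x) ≡ x
      w∘ψ = Inverse.strictlyInverseʳ (proj₁ iso)

      ψ-hom : ∀ x y → ψ (x ∙ y) ≡ ψ x ⊕ ψ y
      ψ-hom = proj₂ iso

      ψ-diff : ∀ x y → ψ (y ∙ x ⁻¹) ≡ ψ y ⊕ ψ x
      ψ-diff x y = trans (cong (ψ ∘ (y ∙_)) (self-inverse x)) (ψ-hom y x)

      w-diff : ∀ p q → w q ∙ w p ⁻¹ ≡ w (q ⊕ p)
      w-diff p q = begin
        w q ∙ w p ⁻¹               ≡⟨ cong (w q ∙_) (self-inverse (w p)) ⟩
        w q ∙ w p                  ≡⟨ w∘ψ (w q ∙ w p) ⟨
        w (ψ (w q ∙ w p))          ≡⟨ cong w (ψ-hom (w q) (w p)) ⟩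
        w (ψ (w q) ⊕ ψ (w p))      ≡⟨ cong w (cong₂ _⊕_ (ψ∘w q) (ψ∘w p)) ⟩
        w (q ⊕ p)                  ∎

      w≡⇒ψ≡ : ∀ {p x} → w p ≡ x → ψ x ≡ p
      w≡⇒ψ≡ {p} w-p = trans (cong ψ (sym w-p)) (ψ∘w p)

      R⇒R̂ : ∀ {x} → x ∈ R → R̂ (ψ x)
      R⇒R̂ x∈R = Sum.map (λ x≡a → trans (cong ψ x≡a) (w≡⇒ψ≡ w-â))
                         (λ x≡b → trans (cong ψ x≡b) (w≡⇒ψ≡ w-b̂)) (R⊆ x∈R)

      L⇒L̂ : ∀ {x} → x ∈ L → L̂ (ψ x)
      L⇒L̂ x∈L = Sum.map (λ x≡b → trans (cong ψ x≡b) (w≡⇒ψ≡ w-b̂))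
                         (λ x≡c → trans (cong ψ x≡c) (w≡⇒ψ≡ w-ĉ)) (L⊆ x∈L)

      R̂⇒R : ∀ {r} → R̂ r → w r ∈ R
      R̂⇒R (inj₁ refl) = subst (_∈ R) (sym w-â) a∈R
      R̂⇒R (inj₂ refl) = subst (_∈ R) (sym w-b̂) b∈R

      L̂⇒L : ∀ {r} → L̂ r → w r ∈ L
      L̂⇒L (inj₁ refl) = subst (_∈ L) (sym w-b̂) b∈L
      L̂⇒L (inj₂ refl) = subst (_∈ L) (sym w-ĉ) c∈L

      Ψ : V G → Vertex
      Ψ (x , i) = ψ x , i

      W : Vertex → V G
      W (p , i) = w p , i

      edge→ : ∀ {u v} → SCEdge G R L u v → Edge (Ψ u) (Ψ v)
      edge→ (edge₁ {x} {y} d) = subst R̂ (ψ-diff x y) (R⇒R̂ d)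
      edge→ (edge₂ {x} {y} d) = subst L̂ (ψ-diff x y) (L⇒L̂ d)
      edge→ spoke             = refl

      edge← : ∀ u v → Edge u v → SCEdge G R L (W u) (W v)
      edge← (p , zero)     (q , zero)     d    = edge₁ (subst (_∈ R) (sym (w-diff p q)) (R̂⇒R d))
      edge← (p , zero)     (q , suc zero) refl = spoke
      edge← (p , suc zero) (q , suc zero) d    = edge₂ (subst (_∈ L) (sym (w-diff p q)) (L̂⇒L d))

      lift : ∀ ν → IsAutomorphicInvolution ν → Automorphism Γ
      lift ν (ν∘ν , ν-adj) = automorphism σ σ σ∘σ σ∘σ σ-adj σ-adj
        where
        σ : V G → V G
        σ = W ∘ ν ∘ Ψ

        σ∘σ : ∀ u → σ (σ u) ≡ u
        σ∘σ (x , i) = begin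
          W (ν (Ψ (W (ν (ψ x , i)))))  ≡⟨ cong (W ∘ ν) (cong₂ _,_ (ψ∘w _) refl) ⟩
          W (ν (ν (ψ x , i)))          ≡⟨ cong W (ν∘ν (ψ x , i)) ⟩
          w (ψ x) , i                  ≡⟨ cong (_, i) (w∘ψ x) ⟩
          x , i                        ∎

        σ-adj : ∀ {u v} → Γ u v → Γ (σ u) (σ v)
        σ-adj = Sum.map (edge← _ _) (edge← _ _) ∘ ν-adj _ _ ∘ Sum.map edge→ edge→

      vertexTransitive×¬normal : ∀ ν → IsAutomorphicInvolution ν → (p t : C) →
                                 proj₂ (ν (p , zero)) ≡ zero → proj₂ (ν (p ⊕ t , zero)) ≡ suc zero →
                                 VertexTransitive Γ × ¬ Normal G Γ
      vertexTransitive×¬normal ν ν-automorphic p t stays crosses =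
          vertexTransitive (σ , refl) (λ eq → Fin.0≢1+n (trans eq σu′-layer))
        , ¬normal σ (w t) u (λ eq → Fin.0≢1+n (sym (trans (sym σu′-layer) (trans eq σu-layer))))
        where
        σ : Automorphism Γ
        σ = lift ν ν-automorphic

        u : V G
        u = w p , zero

        σu-layer : layer (act σ u) ≡ zero
        σu-layer = trans (cong (λ q → proj₂ (ν (q , zero))) (ψ∘w p)) stays

        σu′-layer : layer (act σ (ρ G (w t) u)) ≡ suc zero
        σu′-layer = trans (cong (λ q → proj₂ (ν (q , zero))) ψ-pt) crosses
          where
          ψ-pt : ψ (w p ∙ w t) ≡ p ⊕ t
          ψ-pt = trans (ψ-hom (w p) (w t)) (cong₂ _⊕_ (ψ∘w p) (ψ∘w t))

  -- The two possible groups

  module Classification {R L : Subset n} (s : Shape R L) (connected : Connected (SCAdj G R L)) where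
    open Shape s
    open SCGraph R L

    RankTwo : Set
    RankTwo = ∃[ a ] ∃[ b ] ((∀ x → ⟪ a ∷ b ∷ [] ⟫ x) × IsoTo G (Bool × Bool) _⊕²_
              × R ≡ ⁅ a ⁆ ∪ ⁅ b ⁆ × L ≡ ⁅ a ∙ b ⁆ ∪ ⁅ b ⁆)

    RankThree : Set
    RankThree = ∃[ a ] ∃[ b ] ∃[ c ] ((∀ x → ⟪ a ∷ b ∷ c ∷ [] ⟫ x) × IsoTo G (Bool × Bool × Bool) _⊕³_
                × R ≡ ⁅ a ⁆ ∪ ⁅ b ⁆ × L ≡ ⁅ b ⁆ ∪ ⁅ c ⁆)

    module RankTwoCase (c≡ab : c ≡ a ∙ b) where

      generated : ∀ x → ⟪ a ∷ b ∷ [] ⟫ x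
      generated = connected⇒generated generators connected
        where
        generators : ∀ {s} → s ∈ R ⊎ s ∈ L → ⟪ a ∷ b ∷ [] ⟫ s
        generators (inj₁ s∈R) = [ (λ s≡a → gen (here s≡a))
                                , (λ s≡b → gen (there (here s≡b))) ]′ (R⊆ s∈R)
        generators (inj₂ s∈L) = [ (λ s≡b → gen (there (here s≡b)))
                                , (λ s≡c → subst ⟪ _ ⟫ (sym (trans s≡c c≡ab))
                                                 (mul (gen (here refl)) (gen (there (here refl)))))
                                ]′ (L⊆ s∈L)

      elementary : ∀ x → x ∙ x ≡ ε
      elementary x = ⟨⟩-involutive involutive (generated x)
        where
        involutive : ∀ {s} → s ∈ˡ a ∷ b ∷ [] → s ∙ s ≡ ε
        involutive (here refl)         = a-involution
        involutive (there (here refl)) = b-involution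

      open Exponent2 elementary

      w : Bool × Bool → Fin n
      w = extend a (b ^_)

      w-hom : Hom _⊕²_ w
      w-hom = extend-hom {_⊕_ = _xor_} a (^-hom b)

      w-injective : Injective _≡_ _≡_ w
      w-injective = extend-injective {_⊕_ = _xor_} (^-hom b) (^-injective b≢ε) λ
        { false → a≢ε ∘ sym
        ; true  → a≢b ∘ sym }

      w-a : w (true , false) ≡ a
      w-a = identityʳ a

      w-b : w (false , true) ≡ b
      w-b = identityˡ b

      iso : IsoTo G (Bool × Bool) _⊕²_
      iso = bijectiveHom⇒IsoTo {_⊕_ = _⊕²_} w-hom w-injective λ x →
        ⟨⟩⊆image {_⊕_ = _⊕²_} w-hom (false , false) basis (generated x)
        where
        basis : ∀ {s} → s ∈ˡ a ∷ b ∷ [] → ∃ λ p → w p ≡ s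
        basis (here refl)         = (true , false) , w-a
        basis (there (here refl)) = (false , true) , w-b

      open Transfer s {_⊕_ = _⊕²_} iso (≡-dec Bool._≟_ Bool._≟_)
        {true , false} {false , true} {true , true} w-a w-b (sym c≡ab)

      -- Γ is a cube; ν swaps the a-coordinate with the layer, flipping the b-coordinate
      -- when both are 1.
      ν : Vertex → Vertex
      ν ((false , j) , suc zero) = (true  , j)     , zero
      ν ((true  , j) , zero)     = (false , j)     , suc zero
      ν ((true  , j) , suc zero) = (true  , not j) , suc zero
      ν v                        = v

      result : VertexTransitive Γ × ¬ Normal G Γ × RankTwo
      result = map₂ (_, rankTwo) (vertexTransitive×¬normal ν
        (from-yes (isAutomorphicInvolution? (searchable-× searchable-Bool searchable-Bool) ν))
        (false , false) (true , false) refl refl)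
        where
        rankTwo : RankTwo
        rankTwo = a , b , generated , iso , ≡⁅x⁆∪⁅y⁆ a∈R b∈R R⊆
                , ≡⁅x⁆∪⁅y⁆ (subst (_∈ L) c≡ab c∈L) b∈L
                           (Sum.swap ∘ Sum.map₂ (λ y≡c → trans y≡c c≡ab) ∘ L⊆)

    module RankThreeCase (c≢ab : c ≢ a ∙ b) where

      generated : ∀ x → ⟪ a ∷ b ∷ c ∷ [] ⟫ x
      generated = connected⇒generated generators connected
        where
        generators : ∀ {s} → s ∈ R ⊎ s ∈ L → ⟪ a ∷ b ∷ c ∷ [] ⟫ s
        generators (inj₁ s∈R) = [ (λ s≡a → gen (here s≡a))
                                , (λ s≡b → gen (there (here s≡b))) ]′ (R⊆ s∈R)
        generators (inj₂ s∈L) = [ (λ s≡b → gen (there (here s≡b)))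
                                , (λ s≡c → gen (there (there (here s≡c)))) ]′ (L⊆ s∈L)

      elementary : ∀ x → x ∙ x ≡ ε
      elementary x = ⟨⟩-involutive involutive (generated x)
        where
        involutive : ∀ {s} → s ∈ˡ a ∷ b ∷ c ∷ [] → s ∙ s ≡ ε
        involutive (here refl)                 = a-involution
        involutive (there (here refl))         = b-involution
        involutive (there (there (here refl))) = c-involution

      open Exponent2 elementary

      w′ : Bool × Bool → Fin n
      w′ = extend b (c ^_)

      w : Bool × Bool × Bool → Fin n
      w = extend a w′

      w′-hom : Hom _⊕²_ w′
      w′-hom = extend-hom {_⊕_ = _xor_} b (^-hom c)

      w-hom : Hom _⊕³_ w
      w-hom = extend-hom {_⊕_ = _⊕²_} a w′-hom

      w-injective : Injective _≡_ _≡_ w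
      w-injective = extend-injective {_⊕_ = _⊕²_} w′-hom w′-injective a∉⟨b,c⟩
        where
        w′-injective : Injective _≡_ _≡_ w′
        w′-injective = extend-injective {_⊕_ = _xor_} (^-hom c) (^-injective c≢ε) λ
          { false → b≢ε ∘ sym
          ; true  → b≢c ∘ sym }

        a∉⟨b,c⟩ : ∀ p → w′ p ≢ a
        a∉⟨b,c⟩ (false , false) ε∙ε≡a = a≢ε (trans (sym ε∙ε≡a) (identityʳ ε))
        a∉⟨b,c⟩ (false , true)  ε∙c≡a = a≢c (trans (sym ε∙c≡a) (identityˡ c))
        a∉⟨b,c⟩ (true  , false) b∙ε≡a = a≢b (trans (sym b∙ε≡a) (identityʳ b))
        a∉⟨b,c⟩ (true  , true)  b∙c≡a = c≢ab (trans (x∙y≡z⇒y≡x∙z b∙c≡a) (comm b a))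

      w-a : w (true , false , false) ≡ a
      w-a = trans (cong (a ∙_) (identityʳ ε)) (identityʳ a)

      w-b : w (false , true , false) ≡ b
      w-b = trans (identityˡ _) (identityʳ b)

      w-c : w (false , false , true) ≡ c
      w-c = trans (identityˡ _) (identityˡ c)

      iso : IsoTo G (Bool × Bool × Bool) _⊕³_
      iso = bijectiveHom⇒IsoTo {_⊕_ = _⊕³_} w-hom w-injective λ x →
        ⟨⟩⊆image {_⊕_ = _⊕³_} w-hom (false , false , false) basis (generated x)
        where
        basis : ∀ {s} → s ∈ˡ a ∷ b ∷ c ∷ [] → ∃ λ p → w p ≡ s
        basis (here refl)                 = (true , false , false) , w-a
        basis (there (here refl))         = (false , true , false) , w-b
        basis (there (there (here refl))) = (false , false , true) , w-c

      open Transfer s {_⊕_ = _⊕³_} iso (≡-dec Bool._≟_ (≡-dec Bool._≟_ Bool._≟_))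
        {true , false , false} {false , true , false} {false , false , true} w-a w-b w-c

      -- Γ is an 8-cycle in the (a, c, layer) coordinates times an edge in the b-coordinate;
      -- ν is the reflection of the 8-cycle fixing a = c = 0 in layer zero.
      ν : Vertex → Vertex
      ν ((false , j , false) , suc zero) = (true  , j , false) , zero
      ν ((true  , j , false) , zero)     = (false , j , false) , suc zero
      ν ((false , j , true)  , zero)     = (true  , j , true)  , suc zero
      ν ((true  , j , true)  , suc zero) = (false , j , true)  , zero
      ν ((false , j , true)  , suc zero) = (true  , j , false) , suc zero
      ν ((true  , j , false) , suc zero) = (false , j , true)  , suc zero
      ν v                                = v

      result : VertexTransitive Γ × ¬ Normal G Γ × RankThree
      result = map₂ (_, rankThree) (vertexTransitive×¬normal ν
        (from-yes (isAutomorphicInvolution?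
                    (searchable-× searchable-Bool (searchable-× searchable-Bool searchable-Bool)) ν))
        (false , false , false) (true , false , false) refl refl)
        where
        rankThree : RankThree
        rankThree = a , b , c , generated , iso , ≡⁅x⁆∪⁅y⁆ a∈R b∈R R⊆ , ≡⁅x⁆∪⁅y⁆ b∈L c∈L L⊆

    classification : VertexTransitive Γ × ¬ Normal G Γ × (RankTwo ⊎ RankThree)
    classification with c Fin.≟ a ∙ b
    ... | yes c≡ab = map₂ (map₂ inj₁) (RankTwoCase.result c≡ab)
    ... | no  c≢ab = map₂ (map₂ inj₂) (RankThreeCase.result c≢ab)

lemma3p7 : (G : FinAbGroup) → let open FinAbGroup G in
    (∃[ x ] x ≢ ε) →
    (R L : Subset n) →
    InvClosed G R → InvClosed G L →
    ε ∉ (R ∪ L) →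
    ∣ R ∣ ≡ 2 → ∣ L ∣ ≡ 2 → ∣ R ∩ L ∣ ≡ 1 →
    Connected (SCAdj G R L) →
    VertexTransitive (SCAdj G R L) × ¬ Normal G (SCAdj G R L) ×
    ((∃[ a ] ∃[ b ] ((∀ x → ⟨_⟩ G (a ∷ b ∷ []) x) × IsoTo G (Bool × Bool) _⊕²_
        × R ≡ ⁅ a ⁆ ∪ ⁅ b ⁆ × L ≡ ⁅ a ∙ b ⁆ ∪ ⁅ b ⁆))
     ⊎ (∃[ a ] ∃[ b ] ∃[ c ] ((∀ x → ⟨_⟩ G (a ∷ b ∷ c ∷ []) x) × IsoTo G (Bool × Bool × Bool) _⊕³_
        × R ≡ ⁅ a ⁆ ∪ ⁅ b ⁆ × L ≡ ⁅ b ⁆ ∪ ⁅ c ⁆)))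
-- The hypothesis G ≠ 1 is redundant: R contains an element other than ε.
lemma3p7 G _ R L R⁻¹ L⁻¹ ε∉R∪L ∣R∣≡2 ∣L∣≡2 ∣R∩L∣≡1 connected =
  Classification.classification G (shape G R⁻¹ L⁻¹ ε∉R∪L ∣R∣≡2 ∣L∣≡2 ∣R∩L∣≡1) connected
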